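{- Let $P \subset \mathbb{R}^d$ be an $r$-dimensional lattice polytope, and let $e_0(P),\dots,e_r(P)$ be the coefficients of its Ehrhart polynomial. Then \[ \mathrm{CE}(P;n) \;=\; e_r(P)\, J_r(n) + e_{r-1}(P)\, J_{r-1}(n) + \cdots + e_0(P)\, J_0(n) \] for all integers $n \ge 0$.
   Context: A lattice polytope is a convex polytope with all vertices in $\mathbb{Z}^d$. For $n \in \mathbb{Z}_{\ge 0}$, $nP = \{np : p \in P\}$. The Ehrhart function $E(P;n) = |nP \cap \mathbb{Z}^d|$ agrees for all $n \ge 0$ with a polynomial $e_r(P)n^r + \cdots + e_0(P)n^0$ of degree $r=\dim P$ (Ehrhart's theorem); $e_i(P)$ denote its coefficients. The coprime Ehrhart function is \[ \mathrm{CE}(P;n) = |\{(a_1,\dots,a_d) \in nP \cap \mathbb{Z}^d : \gcd(a_1,\dots,a_d,n) = 1\}|. \] For $k \ge 0$, the Jordan totient function is $J_k(n) = |\{(a_1,\dots,a_k)\in\mathbb{Z}^k : 1 \le a_i \le n \text{ for all } i,\ \gcd(a_1,\dots,a_k,n)=1\}|$; in particular $J_0(n)=1$ if $n=1$ and $J_0(n)=0$ otherwise, and $J_1$ is Euler's totient function. -}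

module Defs where

open import Data.Nat as ℕ using (ℕ; zero; suc)
open import Data.Nat.GCD using (gcd)
open import Data.Integer as ℤ using (ℤ; +_; ∣_∣)
open import Data.Rational as ℚ using (ℚ; _/_; 0ℚ; 1ℚ)
open import Data.Fin using (Fin; zero; suc)
open import Data.Vec as Vec using (Vec; lookup; toList)
open import Data.List as List using (List; []; _∷_; length; filter; foldr; map; concatMap; applyUpTo)
open import Data.List.Membership.Propositional using (_∈_)
open import Data.List.Relation.Unary.Unique.Propositional using (Unique)
open import Data.Product using (Σ; ∃; _×_)
open import Function.Bundles using (_⇔_)
open import Relation.Binary.PropositionalEquality using (_≡_)

ℤ→ℚ : ℤ → ℚ
ℤ→ℚ z = z / 1

ℕ→ℚ : ℕ → ℚ
ℕ→ℚ n = + n / 1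

∑ : ∀ {m} → (Fin m → ℚ) → ℚ
∑ {zero}  f = 0ℚ
∑ {suc m} f = f zero ℚ.+ ∑ (λ i → f (suc i))

_^ℚ_ : ℚ → ℕ → ℚ
q ^ℚ zero  = 1ℚ
q ^ℚ suc k = q ℚ.* (q ^ℚ k)

gcdList : List ℕ → ℕ
gcdList = foldr gcd 0

HasSize : ∀ {A : Set} → (A → Set) → ℕ → Set
HasSize {A} S k =
  Σ (List A) λ xs → Unique xs × (∀ x → (S x ⇔ (x ∈ xs))) × (length xs ≡ k)

-- A lattice polytope P ⊂ ℝ^d is given as the convex hull of finitely many
-- integer points V 0, …, V (m-1) ∈ ℤ^d.
Points : ℕ → ℕ → Set
Points d m = Fin m → Vec ℤ d

InDilate : ∀ {d m} → Points d m → ℕ → Vec ℤ d → Set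
InDilate {d} {m} V n p =
  Σ (Fin m → ℚ) λ lam →
    (∀ i → 0ℚ ℚ.≤ lam i) ×
    (∑ lam ≡ 1ℚ) ×
    (∀ (j : Fin d) → ℤ→ℚ (lookup p j) ≡ ℕ→ℚ n ℚ.* ∑ (λ i → lam i ℚ.* ℤ→ℚ (lookup (V i) j)))

CoprimeTo : ∀ {d} → ℕ → Vec ℤ d → Set
CoprimeTo n p = gcdList (n ∷ map ∣_∣ (toList p)) ≡ 1

AffinelyIndependent : ∀ {d k} → (Fin (suc k) → Vec ℤ d) → Set
AffinelyIndependent {d} {k} w =
  ∀ (c : Fin (suc k) → ℚ) →
    ∑ c ≡ 0ℚ →
    (∀ (j : Fin d) → ∑ (λ i → c i ℚ.* ℤ→ℚ (lookup (w i) j)) ≡ 0ℚ) →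
    ∀ i → c i ≡ 0ℚ

HasDim : ∀ {d m} → Points d m → ℕ → Set
HasDim {d} {m} V r =
  (Σ (Fin (suc r) → Fin m) λ f → AffinelyIndependent (λ i → V (f i))) ×
  (∀ (g : Fin (suc (suc r)) → Fin m) → AffinelyIndependent (λ i → V (g i)) → Data.Empty.⊥)
  where import Data.Empty

tuples : ℕ → ℕ → List (List ℕ)
tuples zero    n = [] ∷ []
tuples (suc k) n = concatMap (λ a → map (a ∷_) (tuples k n)) (applyUpTo suc n)

J : ℕ → ℕ → ℕ
J k n = length (filter (λ as → gcdList (n ∷ as) ℕ.≟ 1) (tuples k n))

-- A lattice point p of nP (n ≥ 1) has g = gcd(p, n) dividing n, and p ↦ p / g identifies the
-- points of nP with this gcd with the points of (n/g)P that are coprime to n/g; hence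
-- E(P; n) = Σ_{g ∣ n} CE(P; n/g). Stratifying {1, …, n}^k in the same way gives
-- n^k = Σ_{g ∣ n} J_k(n/g), so by E(P; n) = Σ_i e_i n^i the function n ↦ Σ_i e_i J_i(n) satisfies the
-- same divisor-sum relation as CE(P; ·). In that relation the term g = 1 is the only one not
-- determined by smaller n, so strong induction on n gives the theorem. Membership in nP is not
-- decidable here, so an enumeration of nP exists only under double negation; this suffices
-- because the goal is an equation between rationals, which is decidable.

module Submission where

open import Algebra.Bundles using (CommutativeRing; Ring)
open import Data.Bool using (true; false; if_then_else_)
open import Data.Fin using (Fin; zero; suc; toℕ)
open import Data.Integer as ℤ using (ℤ; -[1+_])
import Data.Integer.Properties as ℤ
open import Data.Integer.Divisibility.Signed as Signed using (∣ᵤ⇒∣)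
open import Data.Integer.GCD using (gcd-zeroʳ)
open import Data.List
  using (List; []; _∷_; _++_; length; filter; map; deduplicate; applyUpTo; concatMap; cartesianProductWith)
open import Data.List.Membership.Propositional using (_∈_)
open import Data.List.Membership.Propositional.Properties
  using (∈-filter⁺; ∈-filter⁻; ∈-map⁺; ∈-map⁻; deduplicate-∈⇔; ∈-applyUpTo⁺; ∈-applyUpTo⁻;
         ∈-cartesianProductWith⁺; ∈-cartesianProductWith⁻; ∈-++⁺ˡ; ∈-++⁺ʳ)
open import Data.List.Membership.Propositional.Properties.WithK using (unique∧set⇒bag)
open import Data.List.Properties
  using (filter-none; length-map; length-++; length-applyUpTo; map-injective; ∷-injective)
open import Data.List.Relation.Binary.BagAndSetEquality using (∼bag⇒↭)
open import Data.List.Relation.Binary.Permutation.Propositional.Properties using (↭-length)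
open import Data.List.Relation.Unary.All as All using (All; []; _∷_)
import Data.List.Relation.Unary.All.Properties as All
import Data.List.Relation.Unary.AllPairs as AllPairs
open import Data.List.Relation.Unary.Any using (here; there)
open import Data.List.Relation.Unary.Unique.Propositional using (Unique)
import Data.List.Relation.Unary.Unique.Propositional.Properties as Unique
open import Data.List.Relation.Unary.Unique.DecPropositional.Properties using (deduplicate-!)
open import Data.Nat as ℕ using (ℕ; zero; suc; _<_; _≤_; z≤n; s≤s; NonZero; _≟_)
open import Data.Nat.Divisibility using (_∣_; _∣?_; divides; 1∣_; 0∣⇒≡0; ∣⇒≤; ∣-trans)
open import Data.Nat.GCD using (gcd; gcd[m,n]∣m; gcd[m,n]∣n; c*gcd[m,n]≡gcd[cm,cn]; gcd[0,0]≡0)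
open import Data.Nat.Induction using (<-rec)
import Data.Nat.Properties as ℕ
open import Data.Product using (Σ; ∃; _×_; _,_; proj₁; proj₂)
open import Data.Product.Function.NonDependent.Propositional using (_×-⇔_)
open import Data.Rational as ℚ using (ℚ; 0ℚ; 1ℚ; _+_; _*_; ↥_; ↧_; toℚᵘ)
import Data.Rational.Properties as ℚ
open import Data.Rational.Unnormalised as ℚᵘ using (mkℚᵘ; *≡*; *≤*) renaming (_≃_ to _≃ᵘ_)
import Data.Rational.Unnormalised.Properties as ℚᵘ
open import Data.Vec as Vec using (Vec; lookup; toList)
open import Data.Vec.Properties using (≡-dec; lookup-map; ∷-injectiveˡ; ∷-injectiveʳ)
open import Effect.Monad using (RawMonad)
open import Function.Base using (_∘_; id; it)
open import Function.Bundles using (_⇔_; mk⇔; Equivalence)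
open import Function.Construct.Composition using (_⇔-∘_)
open import Function.Construct.Symmetry using (⇔-sym)
open import Level using (0ℓ)
open import Relation.Binary.Definitions using (DecidableEquality)
open import Relation.Binary.PropositionalEquality
  using (_≡_; refl; sym; trans; cong; cong₂; subst; subst₂; module ≡-Reasoning)
open import Relation.Nullary using (¬_; Dec; yes; no; contradiction; ¬¬-excluded-middle)
open import Relation.Nullary.Decidable using (decidable-stable)
open import Relation.Nullary.Negation using (¬¬-Monad; ¬¬-map)
open import Relation.Unary using (Decidable)

open import Defs

open import Algebra.Properties.Semiring.Sum (CommutativeRing.semiring ℚ.+-*-commutativeRing)
  using (sum; sum-cong-≗; sum-replicate-zero; ∑-comm; ∑-distrib-+; *-distribˡ-sum; *-distribʳ-sum)
open import Algebra.Properties.Group (Ring.+-group ℚ.+-*-ring) using () renaming (∙-cancelʳ to +-cancelʳ)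

open RawMonad (¬¬-Monad {0ℓ}) using (_>>=_; return)
open Equivalence using (to; from)

private
  variable
    A : Set
    S P : A → Set
    xs ys : List A

-- Finite sets as duplicate-free enumerations

Enumerates : (A → Set) → List A → Set
Enumerates S xs = Unique xs × (∀ x → S x ⇔ x ∈ xs)

enumeration-length : Enumerates S xs → Enumerates S ys → length xs ≡ length ys
enumeration-length (uxs , exs) (uys , eys) =
  ↭-length (∼bag⇒↭ (unique∧set⇒bag uxs uys λ {x} → eys x ⇔-∘ ⇔-sym (exs x)))

HasSize-unique : ∀ {a b} → HasSize S a → HasSize S b → a ≡ b
HasSize-unique (xs , uxs , exs , refl) (ys , uys , eys , refl) = enumeration-length (uxs , exs) (uys , eys)

Enumerates⇒HasSize : Enumerates S xs → HasSize S (length xs)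
Enumerates⇒HasSize {xs = xs} (uxs , exs) = xs , uxs , exs , refl

filter-enumerates : Enumerates S xs → (P? : Decidable P) →
                    Enumerates (λ x → S x × P x) (filter P? xs)
filter-enumerates (uxs , exs) P? = Unique.filter⁺ P? uxs , λ x →
  mk⇔ (λ (s , p) → ∈-filter⁺ P? (to (exs x) s) p)
      (λ x∈ → let (x∈xs , p) = ∈-filter⁻ P? x∈ in from (exs x) x∈xs , p)

HasSize-resp-⇔ : ∀ {k} → (∀ x → S x ⇔ P x) → HasSize S k → HasSize P k
HasSize-resp-⇔ S⇔P (xs , uxs , exs , len) = xs , uxs , (λ x → exs x ⇔-∘ ⇔-sym (S⇔P x)) , len

map-of-images : ∀ {B : Set} {f : A → B} {xs} → All (λ x → ∃ λ y → x ≡ f y) xs → ∃ λ ys → xs ≡ map f ys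
map-of-images [] = [] , refl
map-of-images ((y , refl) ∷ images) = let (ys , xs≡) = map-of-images images in y ∷ ys , cong (_ ∷_) xs≡

preimage-HasSize : ∀ {B : Set} {Q : B → Set} {f : A → B} {zs} → (∀ {x y} → f x ≡ f y → x ≡ y) →
  Enumerates Q zs → (∀ z → Q z → ∃ λ y → z ≡ f y) → HasSize (Q ∘ f) (length zs)
preimage-HasSize {f = f} f-injective (uzs , ezs) onto
  with map-of-images (All.tabulate λ {z} z∈zs → onto z (from (ezs z) z∈zs))
... | ys , refl = ys , Unique.map⁻ uzs , (λ y → ∈-map-injective ⇔-∘ ezs (f y)) , sym (length-map f ys)
  where
  ∈-map-injective : ∀ {y} → f y ∈ map f ys ⇔ y ∈ ys
  ∈-map-injective = mk⇔
    (λ fy∈ → let (_ , y′∈ , fy≡fy′) = ∈-map⁻ f fy∈ in subst (_∈ ys) (sym (f-injective fy≡fy′)) y′∈)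
    (∈-map⁺ f)

¬¬-filter : (P : A → Set) (B : List A) →
            ¬ ¬ (Σ (List A) λ xs → ∀ x → x ∈ xs ⇔ (x ∈ B × P x))
¬¬-filter P [] = return ([] , λ x → mk⇔ (λ ()) (λ ()))
¬¬-filter P (b ∷ B) = do
  (xs , exs) ← ¬¬-filter P B
  b? ← ¬¬-excluded-middle
  return (extend xs exs b?)
  where
  extend : ∀ xs → (∀ x → x ∈ xs ⇔ (x ∈ B × P x)) → Dec (P b) →
           Σ (List _) λ ys → ∀ x → x ∈ ys ⇔ (x ∈ b ∷ B × P x)
  extend xs exs (yes pb) = b ∷ xs , λ x → mk⇔
    (λ { (here refl) → here refl , pb ; (there x∈) → let (x∈B , px) = to (exs x) x∈ in there x∈B , px })
    (λ { (here refl , _) → here refl ; (there x∈B , px) → there (from (exs x) (x∈B , px)) })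
  extend xs exs (no ¬pb) = xs , λ x → mk⇔
    (λ x∈ → let (x∈B , px) = to (exs x) x∈ in there x∈B , px)
    (λ { (here refl , pb) → contradiction pb ¬pb ; (there x∈B , px) → from (exs x) (x∈B , px) })

¬¬-enumerable : DecidableEquality A → (B : List A) → (∀ x → S x → x ∈ B) →
                ¬ ¬ Σ (List A) (Enumerates S)
¬¬-enumerable {S = S} _≟_ B S⊆B = do
  (xs , exs) ← ¬¬-filter S B
  return (deduplicate _≟_ xs , deduplicate-! _≟_ xs , λ x →
    deduplicate-∈⇔ _≟_ ⇔-∘ (⇔-sym (exs x) ⇔-∘ mk⇔ (λ s → S⊆B x s , s) proj₂))

-- Identities of casts are proved in ℚᵘ, where the cast is mkℚᵘ z 0 and no normalisation occurs.
ℤ→ℚ≃mkℚᵘ : ∀ z → toℚᵘ (ℤ→ℚ z) ≃ᵘ mkℚᵘ z 0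
ℤ→ℚ≃mkℚᵘ z =
  *≡* (cong₂ ℤ._*_ (trans (ℚ.↥ᵘ-toℚᵘ (ℤ→ℚ z)) ↥z) (sym (trans (ℚ.↧ᵘ-toℚᵘ (ℤ→ℚ z)) ↧z)))
  where
  ↥z : ↥ (ℤ→ℚ z) ≡ z
  ↥z = trans (sym (ℤ.*-identityʳ _)) (trans (cong (↥ (ℤ→ℚ z) ℤ.*_) (sym (gcd-zeroʳ z))) (ℚ.↥-/ z 1))
  ↧z : ↧ (ℤ→ℚ z) ≡ ℤ.+ 1
  ↧z = trans (sym (ℤ.*-identityʳ _)) (trans (cong (↧ (ℤ→ℚ z) ℤ.*_) (sym (gcd-zeroʳ z))) (ℚ.↧-/ z 1))

ℤ→ℚ-+ : ∀ a b → ℤ→ℚ (a ℤ.+ b) ≡ ℤ→ℚ a + ℤ→ℚ b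
ℤ→ℚ-+ a b = ℚ.toℚᵘ-injective (ℚᵘ.≃-trans (ℤ→ℚ≃mkℚᵘ (a ℤ.+ b)) (ℚᵘ.≃-trans mkℚᵘ-+
  (ℚᵘ.≃-sym (ℚᵘ.≃-trans (ℚ.toℚᵘ-homo-+ (ℤ→ℚ a) (ℤ→ℚ b))
                         (ℚᵘ.+-cong (ℤ→ℚ≃mkℚᵘ a) (ℤ→ℚ≃mkℚᵘ b))))))
  where
  mkℚᵘ-+ : mkℚᵘ (a ℤ.+ b) 0 ≃ᵘ mkℚᵘ a 0 ℚᵘ.+ mkℚᵘ b 0
  mkℚᵘ-+ = *≡* (cong₂ (λ x y → (x ℤ.+ y) ℤ.* ℤ.+ 1) (sym (ℤ.*-identityʳ a)) (sym (ℤ.*-identityʳ b)))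

ℤ→ℚ-* : ∀ a b → ℤ→ℚ (a ℤ.* b) ≡ ℤ→ℚ a * ℤ→ℚ b
ℤ→ℚ-* a b = ℚ.toℚᵘ-injective (ℚᵘ.≃-trans (ℤ→ℚ≃mkℚᵘ (a ℤ.* b)) (ℚᵘ.≃-trans (*≡* refl)
  (ℚᵘ.≃-sym (ℚᵘ.≃-trans (ℚ.toℚᵘ-homo-* (ℤ→ℚ a) (ℤ→ℚ b))
                         (ℚᵘ.*-cong (ℤ→ℚ≃mkℚᵘ a) (ℤ→ℚ≃mkℚᵘ b))))))

ℤ→ℚ-injective : ∀ {a b} → ℤ→ℚ a ≡ ℤ→ℚ b → a ≡ b
ℤ→ℚ-injective {a} {b} eq
  with ℚᵘ.≃-trans (ℚᵘ.≃-sym (ℤ→ℚ≃mkℚᵘ a)) (ℚᵘ.≃-trans (ℚᵘ.≃-reflexive (cong toℚᵘ eq)) (ℤ→ℚ≃mkℚᵘ b))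
... | *≡* a*1≡b*1 = ℤ.*-cancelʳ-≡ a b (ℤ.+ 1) a*1≡b*1

ℕ→ℚ-+ : ∀ a b → ℕ→ℚ (a ℕ.+ b) ≡ ℕ→ℚ a + ℕ→ℚ b
ℕ→ℚ-+ a b = ℤ→ℚ-+ (ℤ.+ a) (ℤ.+ b)

ℕ→ℚ-* : ∀ a b → ℕ→ℚ (a ℕ.* b) ≡ ℕ→ℚ a * ℕ→ℚ b
ℕ→ℚ-* a b = trans (cong ℤ→ℚ (ℤ.pos-* a b)) (ℤ→ℚ-* (ℤ.+ a) (ℤ.+ b))

ℕ→ℚ-^ : ∀ a k → ℕ→ℚ (a ℕ.^ k) ≡ ℕ→ℚ a ^ℚ k
ℕ→ℚ-^ a zero = refl
ℕ→ℚ-^ a (suc k) = trans (ℕ→ℚ-* a (a ℕ.^ k)) (cong (ℕ→ℚ a *_) (ℕ→ℚ-^ a k))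

ℕ→ℚ-cancel-≤ : ∀ {a b} → ℕ→ℚ a ℚ.≤ ℕ→ℚ b → a ≤ b
ℕ→ℚ-cancel-≤ {a} {b} a≤b
  with ℚᵘ.≤-respʳ-≃ (ℤ→ℚ≃mkℚᵘ (ℤ.+ b)) (ℚᵘ.≤-respˡ-≃ (ℤ→ℚ≃mkℚᵘ (ℤ.+ a)) (ℚ.toℚᵘ-mono-≤ a≤b))
... | *≤* a*1≤b*1 = ℤ.drop‿+≤+ (subst₂ ℤ._≤_ (ℤ.*-identityʳ _) (ℤ.*-identityʳ _) a*1≤b*1)

∣ℤ→ℚ∣ : ∀ z → ℚ.∣ ℤ→ℚ z ∣ ≡ ℕ→ℚ ℤ.∣ z ∣
∣ℤ→ℚ∣ (ℤ.+ n) = ℚ.0≤p⇒∣p∣≡p (ℚ.nonNegative⁻¹ _ {{ℚ.normalize-nonNeg n 1}})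
∣ℤ→ℚ∣ -[1+ n ] = trans (ℚ.∣-p∣≡∣p∣ (ℕ→ℚ (suc n))) (∣ℤ→ℚ∣ (ℤ.+ suc n))

ℕ→ℚ-nonZero : ∀ g .{{_ : NonZero g}} → ℚ.NonZero (ℕ→ℚ g)
ℕ→ℚ-nonZero g@(suc _) = ℚ.pos⇒nonZero (ℕ→ℚ g) {{ℚ.normalize-pos g 1}}

*-cancelˡ-≡ : ∀ c .{{_ : ℚ.NonZero c}} {x y} → c * x ≡ c * y → x ≡ y
*-cancelˡ-≡ c {x} {y} cx≡cy = begin
  x                   ≡⟨ sym (ℚ.*-identityˡ x) ⟩
  1ℚ * x              ≡⟨ cong (_* x) (sym (ℚ.*-inverseˡ c)) ⟩
  ℚ.1/ c * c * x      ≡⟨ ℚ.*-assoc (ℚ.1/ c) c x ⟩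
  ℚ.1/ c * (c * x)    ≡⟨ cong (ℚ.1/ c *_) cx≡cy ⟩
  ℚ.1/ c * (c * y)    ≡⟨ ℚ.*-assoc (ℚ.1/ c) c y ⟨
  ℚ.1/ c * c * y      ≡⟨ cong (_* y) (ℚ.*-inverseˡ c) ⟩
  1ℚ * y              ≡⟨ ℚ.*-identityˡ y ⟩
  y                   ∎
  where open ≡-Reasoning

ℕ→ℚ-mono-≤ : ∀ {a b} → a ≤ b → ℕ→ℚ a ℚ.≤ ℕ→ℚ b
ℕ→ℚ-mono-≤ {a} {b} a≤b = ℚ.toℚᵘ-cancel-≤
  (ℚᵘ.≤-respʳ-≃ (ℚᵘ.≃-sym (ℤ→ℚ≃mkℚᵘ (ℤ.+ b))) (ℚᵘ.≤-respˡ-≃ (ℚᵘ.≃-sym (ℤ→ℚ≃mkℚᵘ (ℤ.+ a)))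
    (*≤* (subst₂ ℤ._≤_ (sym (ℤ.*-identityʳ _)) (sym (ℤ.*-identityʳ _)) (ℤ.+≤+ a≤b)))))

∑≡sum : ∀ {n} (f : Fin n → ℚ) → ∑ f ≡ sum f
∑≡sum {zero} f = refl
∑≡sum {suc n} f = cong (f zero +_) (∑≡sum (λ i → f (suc i)))

∑-cong : ∀ {n} {f g : Fin n → ℚ} → (∀ i → f i ≡ g i) → ∑ f ≡ ∑ g
∑-cong {f = f} {g} f≡g = trans (∑≡sum f) (trans (sum-cong-≗ f≡g) (sym (∑≡sum g)))

∑-mono-≤ : ∀ {n} {f g : Fin n → ℚ} → (∀ i → f i ℚ.≤ g i) → ∑ f ℚ.≤ ∑ g
∑-mono-≤ {zero} _ = ℚ.≤-refl
∑-mono-≤ {suc n} f≤g = ℚ.+-mono-≤ (f≤g zero) (∑-mono-≤ (f≤g ∘ suc))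

∣∑∣≤∑∣∣ : ∀ {n} (f : Fin n → ℚ) → ℚ.∣ ∑ f ∣ ℚ.≤ ∑ (λ i → ℚ.∣ f i ∣)
∣∑∣≤∑∣∣ {zero} f = ℚ.≤-refl
∣∑∣≤∑∣∣ {suc n} f =
  ℚ.≤-trans (ℚ.∣p+q∣≤∣p∣+∣q∣ (f zero) _) (ℚ.+-monoʳ-≤ ℚ.∣ f zero ∣ (∣∑∣≤∑∣∣ (f ∘ suc)))

convex-combination-∣≤∣ : ∀ {n} (w x : Fin n → ℚ) {M} → (∀ i → 0ℚ ℚ.≤ w i) → ∑ w ≡ 1ℚ →
                         (∀ i → ℚ.∣ x i ∣ ℚ.≤ M) → ℚ.∣ ∑ (λ i → w i * x i) ∣ ℚ.≤ M
convex-combination-∣≤∣ w x {M} w≥0 ∑w≡1 ∣x∣≤M = begin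
  ℚ.∣ ∑ (λ i → w i * x i) ∣  ≤⟨ ∣∑∣≤∑∣∣ (λ i → w i * x i) ⟩
  ∑ (λ i → ℚ.∣ w i * x i ∣)  ≤⟨ ∑-mono-≤ ∣wx∣≤wM ⟩
  ∑ (λ i → w i * M)          ≡⟨ trans (∑≡sum (λ i → w i * M)) (sym (*-distribʳ-sum M w)) ⟩
  sum w * M                  ≡⟨ cong (_* M) (trans (sym (∑≡sum w)) ∑w≡1) ⟩
  1ℚ * M                     ≡⟨ ℚ.*-identityˡ M ⟩
  M                          ∎
  where
  open ℚ.≤-Reasoning
  ∣wx∣≤wM : ∀ i → ℚ.∣ w i * x i ∣ ℚ.≤ w i * M
  ∣wx∣≤wM i = begin
    ℚ.∣ w i * x i ∣      ≡⟨ ℚ.∣p*q∣≡∣p∣*∣q∣ (w i) (x i) ⟩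
    ℚ.∣ w i ∣ * ℚ.∣ x i ∣  ≡⟨ cong (_* ℚ.∣ x i ∣) (ℚ.0≤p⇒∣p∣≡p (w≥0 i)) ⟩
    w i * ℚ.∣ x i ∣       ≤⟨ ℚ.*-monoˡ-≤-nonNeg (w i) {{ℚ.nonNegative (w≥0 i)}} (∣x∣≤M i) ⟩
    w i * M              ∎

δ : ℕ → ℕ → ℚ
δ a b = if a ℕ.≡ᵇ b then 1ℚ else 0ℚ

∑-δ : ∀ {n} j → j < n → sum {n} (λ i → δ (suc j) (suc (toℕ i))) ≡ 1ℚ
∑-δ {suc n} zero _ = trans (cong (1ℚ +_) (sum-replicate-zero n)) (ℚ.+-identityʳ 1ℚ)
∑-δ {suc n} (suc j) (s≤s j<n) = trans (ℚ.+-identityˡ _) (∑-δ j j<n)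

-- Divisor sums

-- F g t summed over the factorisations n = t * g; the divisor g runs through 1, …, n as suc i.
onDivisor : ∀ {g n} → (ℕ → ℕ → ℚ) → Dec (g ∣ n) → ℚ
onDivisor {g} F (yes (divides t _)) = F g t
onDivisor F (no _) = 0ℚ

∑-divisors : ℕ → (ℕ → ℕ → ℚ) → ℚ
∑-divisors n F = sum {n} λ i → onDivisor F (suc (toℕ i) ∣? n)

∑-divisors-cong : ∀ n {F G : ℕ → ℕ → ℚ} → (∀ g t .{{_ : NonZero g}} → n ≡ t ℕ.* g → F g t ≡ G g t) →
                  ∑-divisors n F ≡ ∑-divisors n G
∑-divisors-cong n {F} {G} F≡G = sum-cong-≗ {n} λ i → onDivisor-cong (suc (toℕ i) ∣? n)
  where
  onDivisor-cong : ∀ {g} .{{_ : NonZero g}} (g∣?n : Dec (g ∣ n)) → onDivisor F g∣?n ≡ onDivisor G g∣?n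
  onDivisor-cong (yes (divides t n≡tg)) = F≡G _ t n≡tg
  onDivisor-cong (no _) = refl

∑-divisors-supported : ∀ n (f : ℕ → ℚ) → (∀ g → ¬ g ∣ n → f g ≡ 0ℚ) →
                       sum {n} (λ i → f (suc (toℕ i))) ≡ ∑-divisors n (λ g _ → f g)
∑-divisors-supported n f f≡0 = sum-cong-≗ {n} λ i → onDivisor-supported (suc (toℕ i) ∣? n)
  where
  onDivisor-supported : ∀ {g} (g∣?n : Dec (g ∣ n)) → f g ≡ onDivisor (λ g _ → f g) g∣?n
  onDivisor-supported (yes _) = refl
  onDivisor-supported (no g∤n) = f≡0 _ g∤n

∑-divisors-linear : ∀ {m} n (c : Fin m → ℚ) (F : Fin m → ℕ → ℕ → ℚ) →
                    ∑ (λ j → c j * ∑-divisors n (F j)) ≡ ∑-divisors n (λ g t → ∑ (λ j → c j * F j g t))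
∑-divisors-linear {m} n c F = begin
  ∑ (λ j → c j * ∑-divisors n (F j))
    ≡⟨ trans (∑≡sum (λ j → c j * ∑-divisors n (F j))) (sum-cong-≗ {m} λ j → *-distribˡ-sum {n} (c j) (term j)) ⟩
  sum {m} (λ j → sum {n} (λ i → c j * term j i))
    ≡⟨ ∑-comm {m} {n} _ ⟩
  sum {n} (λ i → sum {m} (λ j → c j * term j i))
    ≡⟨ sum-cong-≗ {n} (λ i → onDivisor-linear (suc (toℕ i) ∣? n)) ⟩
  ∑-divisors n (λ g t → ∑ (λ j → c j * F j g t)) ∎
  where
  open ≡-Reasoning
  term : Fin m → Fin n → ℚ
  term j i = onDivisor (F j) (suc (toℕ i) ∣? n)
  onDivisor-linear : ∀ {g} (g∣?n : Dec (g ∣ n)) →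
    sum {m} (λ j → c j * onDivisor (F j) g∣?n) ≡ onDivisor (λ g t → ∑ (λ j → c j * F j g t)) g∣?n
  onDivisor-linear {g} (yes (divides t _)) = sym (∑≡sum (λ j → c j * F j g t))
  onDivisor-linear (no _) = trans (sum-cong-≗ {m} (λ j → ℚ.*-zeroʳ (c j))) (sum-replicate-zero m)

∑-divisors-cancel : ∀ n .{{_ : NonZero n}} {F G : ℕ → ℕ → ℚ} → ∑-divisors n F ≡ ∑-divisors n G →
                    (∀ g t .{{_ : NonZero g}} → 1 < g → n ≡ t ℕ.* g → F g t ≡ G g t) → F 1 n ≡ G 1 n
∑-divisors-cancel n@(suc m) {F} {G} ∑F≡∑G F≡G = +-cancelʳ (rest G) (F 1 n) (G 1 n) (begin
  F 1 n + rest G                ≡⟨ cong₂ _+_ (sym (onDivisor-one F (1 ∣? n))) (sym rest-cong) ⟩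
  onDivisor F (1 ∣? n) + rest F ≡⟨ ∑F≡∑G ⟩
  onDivisor G (1 ∣? n) + rest G ≡⟨ cong (_+ rest G) (onDivisor-one G (1 ∣? n)) ⟩
  G 1 n + rest G                ∎)
  where
  open ≡-Reasoning
  rest : (ℕ → ℕ → ℚ) → ℚ
  rest H = sum {m} λ i → onDivisor H (suc (suc (toℕ i)) ∣? n)
  onDivisor-one : (H : ℕ → ℕ → ℚ) (1∣?n : Dec (1 ∣ n)) → onDivisor H 1∣?n ≡ H 1 n
  onDivisor-one H (yes (divides t n≡t*1)) = cong (H 1) (trans (sym (ℕ.*-identityʳ t)) (sym n≡t*1))
  onDivisor-one H (no 1∤n) = contradiction (1∣ n) 1∤n
  onDivisor-cong : ∀ {g} .{{_ : NonZero g}} → 1 < g → (g∣?n : Dec (g ∣ n)) → onDivisor F g∣?n ≡ onDivisor G g∣?n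
  onDivisor-cong 1<g (yes (divides t n≡tg)) = F≡G _ t 1<g n≡tg
  onDivisor-cong 1<g (no _) = refl
  rest-cong : rest F ≡ rest G
  rest-cong = sum-cong-≗ {m} λ i → onDivisor-cong (s≤s (s≤s z≤n)) (suc (suc (toℕ i)) ∣? n)

cofactor-< : ∀ {n} t g .{{_ : NonZero n}} → 1 < g → n ≡ t ℕ.* g → t < n
cofactor-< t g 1<g n≡tg = subst (t <_) (sym n≡tg) (ℕ.m<m*n t g {{ℕ.m*n≢0⇒m≢0 t {{subst NonZero n≡tg it}}}} 1<g)

-- Stratifying by the gcd with the dilation factor

module _ {A : Set} (key : A → ℕ) where

  stratum : ℕ → List A → List A
  stratum g = filter (λ x → key x ≟ g)

  length-stratum-∷ : ∀ g x xs →
    ℕ→ℚ (length (stratum g (x ∷ xs))) ≡ δ (key x) g + ℕ→ℚ (length (stratum g xs))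
  length-stratum-∷ g x xs with key x ℕ.≡ᵇ g
  ... | true  = ℕ→ℚ-+ 1 (length (stratum g xs))
  ... | false = sym (ℚ.+-identityˡ _)

  length-as-∑-strata : ∀ n xs → (∀ {x} → x ∈ xs → ∃ λ j → key x ≡ suc j × j < n) →
    ℕ→ℚ (length xs) ≡ sum {n} (λ i → ℕ→ℚ (length (stratum (suc (toℕ i)) xs)))
  length-as-∑-strata n [] _ = sym (sum-replicate-zero n)
  length-as-∑-strata n (x ∷ xs) keys with keys (here refl)
  ... | j , key≡ , j<n = begin
    ℕ→ℚ (suc (length xs))
      ≡⟨ ℕ→ℚ-+ 1 (length xs) ⟩
    1ℚ + ℕ→ℚ (length xs)
      ≡⟨ cong₂ _+_ (sym (∑-δ j j<n)) (length-as-∑-strata n xs (keys ∘ there)) ⟩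
    sum {n} (λ i → δ (suc j) (g i)) + sum {n} (λ i → size (g i) xs)
      ≡⟨ ∑-distrib-+ {n} _ _ ⟨
    sum {n} (λ i → δ (suc j) (g i) + size (g i) xs)
      ≡⟨ sum-cong-≗ {n} (λ i → trans (cong (λ k → δ k (g i) + size (g i) xs) (sym key≡))
                                     (sym (length-stratum-∷ (g i) x xs))) ⟩
    sum {n} (λ i → size (g i) (x ∷ xs)) ∎
    where
    open ≡-Reasoning
    g : Fin n → ℕ
    g i = suc (toℕ i)
    size : ℕ → List A → ℚ
    size k ys = ℕ→ℚ (length (stratum k ys))

  length-as-∑-divisors : ∀ n .{{_ : NonZero n}} xs → (∀ {x} → x ∈ xs → key x ∣ n) →
    ℕ→ℚ (length xs) ≡ ∑-divisors n (λ g _ → ℕ→ℚ (length (stratum g xs)))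
  length-as-∑-divisors n xs keys∣n = trans (length-as-∑-strata n xs key-range)
    (∑-divisors-supported n _ λ g g∤n →
      cong (ℕ→ℚ ∘ length) (filter-none (λ x → key x ≟ g)
        (All.tabulate λ x∈ key≡g → g∤n (subst (_∣ n) key≡g (keys∣n x∈)))))
    where
    key-range : ∀ {x} → x ∈ xs → ∃ λ j → key x ≡ suc j × j < n
    key-range {x} x∈ with key x | keys∣n x∈
    ... | zero  | 0∣n = contradiction (0∣⇒≡0 0∣n) (ℕ.≢-nonZero⁻¹ n)
    ... | suc j | j+1∣n = j , refl , ∣⇒≤ j+1∣n

gcdList-scale : ∀ c as → gcdList (map (c ℕ.*_) as) ≡ c ℕ.* gcdList as
gcdList-scale c [] = sym (ℕ.*-zeroʳ c)
gcdList-scale c (a ∷ as) = trans (cong (gcd (c ℕ.* a)) (gcdList-scale c as)) (sym (c*gcd[m,n]≡gcd[cm,cn] c a (gcdList as)))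

gcdList-∣-head : ∀ n as → gcdList (n ∷ as) ∣ n
gcdList-∣-head n as = gcd[m,n]∣m n (gcdList as)

gcdList-∣-tail : ∀ n as → All (gcdList (n ∷ as) ∣_) as
gcdList-∣-tail n as = All.map (∣-trans (gcd[m,n]∣n n (gcdList as))) (gcdList-∣-all as)
  where
  gcdList-∣-all : ∀ as → All (gcdList as ∣_) as
  gcdList-∣-all [] = []
  gcdList-∣-all (a ∷ as) = gcd[m,n]∣m a (gcdList as) ∷ All.map (∣-trans (gcd[m,n]∣n a (gcdList as))) (gcdList-∣-all as)

gcdList-scale-head : ∀ g t as → gcdList (t ℕ.* g ∷ map (g ℕ.*_) as) ≡ g ℕ.* gcdList (t ∷ as)
gcdList-scale-head g t as = trans (cong (λ n → gcdList (n ∷ map (g ℕ.*_) as)) (ℕ.*-comm t g)) (gcdList-scale g (t ∷ as))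

-- Level t of S plays the role of the lattice points of tP (or of {1, …, t}^k), key t x is gcd(x, t),
-- and scale g is multiplication by g.
module GcdStratification {A : Set} (S : ℕ → A → Set) (key : ℕ → A → ℕ) (scale : ℕ → A → A)
  (key-scale : ∀ g t y → key (t ℕ.* g) (scale g y) ≡ g ℕ.* key t y)
  (scale-injective : ∀ g .{{_ : NonZero g}} {x y} → scale g x ≡ scale g y → x ≡ y)
  (S-scale : ∀ g t .{{_ : NonZero g}} y → S (t ℕ.* g) (scale g y) ⇔ S t y)
  (scale-onto : ∀ g t x → key (t ℕ.* g) x ≡ g → ∃ λ y → x ≡ scale g y)
  where

  Primitive : ℕ → A → Set
  Primitive t y = S t y × key t y ≡ 1

  -- Division by g maps the stratum of gcd g at level t * g bijectively onto the primitive part of level t.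
  stratum-HasSize : ∀ {n xs} g t .{{_ : NonZero g}} → n ≡ t ℕ.* g → Enumerates (S n) xs →
                    HasSize (Primitive t) (length (stratum (key n) g xs))
  stratum-HasSize g t refl enum = HasSize-resp-⇔ (λ y → scaled-primitive y)
    (preimage-HasSize (scale-injective g) (filter-enumerates enum (λ x → key (t ℕ.* g) x ≟ g))
                      (λ x → scale-onto g t x ∘ proj₂))
    where
    scaled-primitive : ∀ y → (S (t ℕ.* g) (scale g y) × key (t ℕ.* g) (scale g y) ≡ g) ⇔ Primitive t y
    scaled-primitive y = mk⇔
      (λ (s , k≡g) → to (S-scale g t y) s , *-cancelˡ-1 (trans (sym (key-scale g t y)) k≡g))
      (λ (s , k≡1) → from (S-scale g t y) s ,
                     trans (key-scale g t y) (trans (cong (g ℕ.*_) k≡1) (ℕ.*-identityʳ g)))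
      where
      *-cancelˡ-1 : ∀ {k} → g ℕ.* k ≡ g → k ≡ 1
      *-cancelˡ-1 gk≡g = ℕ.*-cancelˡ-≡ _ _ g (trans gk≡g (sym (ℕ.*-identityʳ g)))

-- Jordan totients

InRange : ℕ → ℕ → Set
InRange n a = 0 < a × a ≤ n

InRange-scale : ∀ g t .{{_ : NonZero g}} a → InRange (t ℕ.* g) (g ℕ.* a) ⇔ InRange t a
InRange-scale g t a = mk⇔
  (λ (0<ga , ga≤tg) → ℕ.>-nonZero⁻¹ a {{ℕ.m*n≢0⇒n≢0 g {{ℕ.>-nonZero 0<ga}}}} ,
                      ℕ.*-cancelˡ-≤ g (subst (g ℕ.* a ≤_) (ℕ.*-comm t g) ga≤tg))
  (λ (0<a , a≤t) → ℕ.>-nonZero⁻¹ (g ℕ.* a) {{ℕ.m*n≢0 g a {{it}} {{ℕ.>-nonZero 0<a}}}} ,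
                   subst (g ℕ.* a ≤_) (ℕ.*-comm g t) (ℕ.*-monoʳ-≤ g a≤t))

∈-applyUpTo-suc : ∀ {a n} → a ∈ applyUpTo suc n ⇔ InRange n a
∈-applyUpTo-suc = mk⇔
  (λ a∈ → let (_ , i<n , a≡1+i) = ∈-applyUpTo⁻ suc a∈ in subst (InRange _) (sym a≡1+i) (s≤s z≤n , i<n))
  (λ { (s≤s z≤n , a≤n) → ∈-applyUpTo⁺ suc a≤n })

tuples-suc : ∀ k n → tuples (suc k) n ≡ cartesianProductWith _∷_ (applyUpTo suc n) (tuples k n)
tuples-suc k n = concatMap≡cartesianProductWith (applyUpTo suc n)
  where
  concatMap≡cartesianProductWith : ∀ as →
    concatMap (λ a → map (a ∷_) (tuples k n)) as ≡ cartesianProductWith _∷_ as (tuples k n)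
  concatMap≡cartesianProductWith [] = refl
  concatMap≡cartesianProductWith (a ∷ as) = cong (map (a ∷_) (tuples k n) ++_) (concatMap≡cartesianProductWith as)

∈-tuples⁻ : ∀ k n {as} → as ∈ tuples k n → length as ≡ k × All (InRange n) as
∈-tuples⁻ zero n (here refl) = refl , []
∈-tuples⁻ (suc k) n as∈
  with ∈-cartesianProductWith⁻ _∷_ (applyUpTo suc n) (tuples k n) (subst (_ ∈_) (tuples-suc k n) as∈)
... | a , bs , a∈ , bs∈ , refl =
  let (len , inRange) = ∈-tuples⁻ k n bs∈ in cong suc len , to ∈-applyUpTo-suc a∈ ∷ inRange

∈-tuples⁺ : ∀ k n {as} → length as ≡ k → All (InRange n) as → as ∈ tuples k n
∈-tuples⁺ zero n {[]} refl [] = here refl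
∈-tuples⁺ (suc k) n {a ∷ as} len (a∈ ∷ inRange) = subst (_ ∈_) (sym (tuples-suc k n))
  (∈-cartesianProductWith⁺ _∷_ (from ∈-applyUpTo-suc a∈) (∈-tuples⁺ k n (ℕ.suc-injective len) inRange))

∈-tuples : ∀ k n as → as ∈ tuples k n ⇔ (length as ≡ k × All (InRange n) as)
∈-tuples k n as = mk⇔ (∈-tuples⁻ k n) λ (len , inRange) → ∈-tuples⁺ k n len inRange

tuples-unique : ∀ k n → Unique (tuples k n)
tuples-unique zero n = [] AllPairs.∷ AllPairs.[]
tuples-unique (suc k) n = subst Unique (sym (tuples-suc k n))
  (Unique.cartesianProductWith⁺ _∷_ ∷-injective
    (Unique.applyUpTo⁺₁ suc n λ i<j _ → ℕ.<⇒≢ i<j ∘ ℕ.suc-injective) (tuples-unique k n))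

length-cartesianProductWith : ∀ {B C : Set} (f : A → B → C) xs ys →
  length (cartesianProductWith f xs ys) ≡ length xs ℕ.* length ys
length-cartesianProductWith f [] ys = refl
length-cartesianProductWith f (x ∷ xs) ys =
  trans (length-++ (map (f x) ys)) (cong₂ ℕ._+_ (length-map (f x) ys) (length-cartesianProductWith f xs ys))

length-tuples : ∀ k n → length (tuples k n) ≡ n ℕ.^ k
length-tuples zero n = refl
length-tuples (suc k) n = trans (cong length (tuples-suc k n))
  (trans (length-cartesianProductWith _∷_ (applyUpTo suc n) (tuples k n))
         (cong₂ ℕ._*_ (length-applyUpTo suc n) (length-tuples k n)))

∈-tuples-scale : ∀ k g t .{{_ : NonZero g}} as → map (g ℕ.*_) as ∈ tuples k (t ℕ.* g) ⇔ as ∈ tuples k t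
∈-tuples-scale k g t as =
  ⇔-sym (∈-tuples k t as) ⇔-∘ ((length-scale ×-⇔ All-scale) ⇔-∘ ∈-tuples k (t ℕ.* g) (map (g ℕ.*_) as))
  where
  length-scale : length (map (g ℕ.*_) as) ≡ k ⇔ length as ≡ k
  length-scale = mk⇔ (trans (sym (length-map (g ℕ.*_) as))) (trans (length-map (g ℕ.*_) as))
  All-scale : All (InRange (t ℕ.* g)) (map (g ℕ.*_) as) ⇔ All (InRange t) as
  All-scale = mk⇔ (All.map (to (InRange-scale g t _)) ∘ All.map⁻) (All.map⁺ ∘ All.map (from (InRange-scale g t _)))

tuples-scale-onto : ∀ g t as → gcdList (t ℕ.* g ∷ as) ≡ g → ∃ λ bs → as ≡ map (g ℕ.*_) bs
tuples-scale-onto g t as key≡g = map-of-images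
  (All.map (λ { (divides q a≡qg) → q , trans a≡qg (ℕ.*-comm q g) })
           (subst (λ d → All (d ∣_) as) key≡g (gcdList-∣-tail (t ℕ.* g) as)))

module Tuples (k : ℕ) = GcdStratification (λ t as → as ∈ tuples k t) (λ t as → gcdList (t ∷ as)) (λ g → map (g ℕ.*_))
  gcdList-scale-head (λ g → map-injective (ℕ.*-cancelˡ-≡ _ _ g)) (∈-tuples-scale k) tuples-scale-onto

tuples-enumerates : ∀ k n → Enumerates (_∈ tuples k n) (tuples k n)
tuples-enumerates k n = tuples-unique k n , λ _ → mk⇔ id id

J-HasSize : ∀ k t → HasSize (Tuples.Primitive k t) (J k t)
J-HasSize k t = Tuples.stratum-HasSize k 1 t (sym (ℕ.*-identityʳ t)) (tuples-enumerates k t)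

jordan : ∀ k n .{{_ : NonZero n}} → ℕ→ℚ n ^ℚ k ≡ ∑-divisors n (λ _ t → ℕ→ℚ (J k t))
jordan k n = begin
  ℕ→ℚ n ^ℚ k
    ≡⟨ trans (cong ℕ→ℚ (length-tuples k n)) (ℕ→ℚ-^ n k) ⟨
  ℕ→ℚ (length (tuples k n))
    ≡⟨ length-as-∑-divisors (λ as → gcdList (n ∷ as)) n (tuples k n) (λ {as} _ → gcdList-∣-head n as) ⟩
  ∑-divisors n (λ g _ → ℕ→ℚ (length (stratum (λ as → gcdList (n ∷ as)) g (tuples k n))))
    ≡⟨ ∑-divisors-cong n (λ g t n≡tg → cong ℕ→ℚ (HasSize-unique
         (Tuples.stratum-HasSize k g t n≡tg (tuples-enumerates k n)) (J-HasSize k t))) ⟩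
  ∑-divisors n (λ _ t → ℕ→ℚ (J k t)) ∎
  where open ≡-Reasoning

J-0 : ∀ k → J k 0 ≡ 0
J-0 zero = refl
J-0 (suc k) = refl

-- Lattice points of dilates

finite-bound : ∀ {n} (f : Fin n → ℕ) → ∃ λ M → ∀ i → f i ≤ M
finite-bound {zero} f = 0 , λ ()
finite-bound {suc n} f = let (M , bound) = finite-bound (f ∘ suc) in
  f zero ℕ.⊔ M , λ { zero → ℕ.m≤m⊔n (f zero) M ; (suc i) → ℕ.m≤n⇒m≤o⊔n (f zero) (bound i) }

integersUpTo : ℕ → List ℤ
integersUpTo R = applyUpTo ℤ.+_ (suc R) ++ applyUpTo -[1+_] R

∈-integersUpTo : ∀ {R} z → ℤ.∣ z ∣ ≤ R → z ∈ integersUpTo R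
∈-integersUpTo (ℤ.+ n) n≤R = ∈-++⁺ˡ (∈-applyUpTo⁺ ℤ.+_ (s≤s n≤R))
∈-integersUpTo {R} -[1+ n ] n<R = ∈-++⁺ʳ (applyUpTo ℤ.+_ (suc R)) (∈-applyUpTo⁺ -[1+_] n<R)

cube : (d : ℕ) → ℕ → List (Vec ℤ d)
cube zero R = Vec.[] ∷ []
cube (suc d) R = cartesianProductWith Vec._∷_ (integersUpTo R) (cube d R)

∈-cube : ∀ {d R} (p : Vec ℤ d) → (∀ j → ℤ.∣ lookup p j ∣ ≤ R) → p ∈ cube d R
∈-cube Vec.[] _ = here refl
∈-cube (z Vec.∷ p) bound = ∈-cartesianProductWith⁺ Vec._∷_ (∈-integersUpTo z (bound zero)) (∈-cube p (bound ∘ suc))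

gcdWith : ∀ {d} → ℕ → Vec ℤ d → ℕ
gcdWith n p = gcdList (n ∷ map ℤ.∣_∣ (toList p))

gcdWith-∣ : ∀ {d} n (p : Vec ℤ d) → gcdWith n p ∣ n
gcdWith-∣ n p = gcdList-∣-head n (map ℤ.∣_∣ (toList p))

scale : ∀ {d} → ℕ → Vec ℤ d → Vec ℤ d
scale g = Vec.map (ℤ.+ g ℤ.*_)

gcdWith-scale : ∀ {d} g t (p : Vec ℤ d) → gcdWith (t ℕ.* g) (scale g p) ≡ g ℕ.* gcdWith t p
gcdWith-scale g t p =
  trans (cong (λ as → gcdList (t ℕ.* g ∷ as)) (∣∣-scale p)) (gcdList-scale-head g t (map ℤ.∣_∣ (toList p)))
  where
  ∣∣-scale : ∀ {d} (p : Vec ℤ d) → map ℤ.∣_∣ (toList (scale g p)) ≡ map (g ℕ.*_) (map ℤ.∣_∣ (toList p))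
  ∣∣-scale Vec.[] = refl
  ∣∣-scale (z Vec.∷ p) = cong₂ _∷_ (ℤ.abs-* (ℤ.+ g) z) (∣∣-scale p)

scale-injective : ∀ {d} g .{{_ : NonZero g}} {p q : Vec ℤ d} → scale g p ≡ scale g q → p ≡ q
scale-injective g {Vec.[]} {Vec.[]} _ = refl
scale-injective g {y Vec.∷ p} {z Vec.∷ q} eq =
  cong₂ Vec._∷_ (ℤ.*-cancelˡ-≡ (ℤ.+ g) y z (∷-injectiveˡ eq)) (scale-injective g (∷-injectiveʳ eq))

scale-onto : ∀ {d} g t (p : Vec ℤ d) → gcdWith (t ℕ.* g) p ≡ g → ∃ λ q → p ≡ scale g q
scale-onto g t p key≡g = divisible-is-scaled p (subst (λ k → All (k ∣_) _) key≡g (gcdList-∣-tail (t ℕ.* g) _))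
  where
  divisible-is-scaled : ∀ {d} (p : Vec ℤ d) → All (g ∣_) (map ℤ.∣_∣ (toList p)) → ∃ λ q → p ≡ scale g q
  divisible-is-scaled Vec.[] [] = Vec.[] , refl
  divisible-is-scaled (z Vec.∷ p) (g∣z ∷ g∣p) with ∣ᵤ⇒∣ {ℤ.+ g} {z} g∣z | divisible-is-scaled p g∣p
  ... | Signed.divides w z≡wg | q , p≡gq = w Vec.∷ q , cong₂ Vec._∷_ (trans z≡wg (ℤ.*-comm w (ℤ.+ g))) p≡gq

module _ {d m} (V : Points d m) where

  vertex-bound : ∃ λ M → ∀ i j → ℤ.∣ lookup (V i) j ∣ ≤ M
  vertex-bound = let (M , M-bound) = finite-bound (proj₁ ∘ row-bound) in
    M , λ i j → ℕ.≤-trans (proj₂ (row-bound i) j) (M-bound i)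
    where
    row-bound : ∀ i → ∃ λ M → ∀ j → ℤ.∣ lookup (V i) j ∣ ≤ M
    row-bound i = finite-bound λ j → ℤ.∣ lookup (V i) j ∣

  dilate-bound : ∀ {M t p} → (∀ i j → ℤ.∣ lookup (V i) j ∣ ≤ M) → InDilate V t p →
                 ∀ j → ℤ.∣ lookup p j ∣ ≤ t ℕ.* M
  dilate-bound {M} {t} {p} bound (w , w≥0 , ∑w≡1 , coords) j = ℕ→ℚ-cancel-≤ (begin
    ℕ→ℚ ℤ.∣ lookup p j ∣    ≡⟨ ∣ℤ→ℚ∣ (lookup p j) ⟨
    ℚ.∣ ℤ→ℚ (lookup p j) ∣  ≡⟨ cong ℚ.∣_∣ (coords j) ⟩
    ℚ.∣ ℕ→ℚ t * s ∣         ≡⟨ trans (ℚ.∣p*q∣≡∣p∣*∣q∣ (ℕ→ℚ t) s) (cong (_* ℚ.∣ s ∣) (∣ℤ→ℚ∣ (ℤ.+ t))) ⟩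
    ℕ→ℚ t * ℚ.∣ s ∣         ≤⟨ ℚ.*-monoˡ-≤-nonNeg (ℕ→ℚ t) {{ℚ.normalize-nonNeg t 1}} ∣s∣≤M ⟩
    ℕ→ℚ t * ℕ→ℚ M           ≡⟨ ℕ→ℚ-* t M ⟨
    ℕ→ℚ (t ℕ.* M)           ∎)
    where
    open ℚ.≤-Reasoning
    s : ℚ
    s = ∑ λ i → w i * ℤ→ℚ (lookup (V i) j)
    ∣s∣≤M : ℚ.∣ s ∣ ℚ.≤ ℕ→ℚ M
    ∣s∣≤M = convex-combination-∣≤∣ w _ w≥0 ∑w≡1 λ i →
      subst (ℚ._≤ ℕ→ℚ M) (sym (∣ℤ→ℚ∣ (lookup (V i) j))) (ℕ→ℚ-mono-≤ (bound i j))

  ¬¬-dilate-enumerable : ∀ t → ¬ ¬ Σ (List (Vec ℤ d)) (Enumerates (InDilate V t))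
  ¬¬-dilate-enumerable t = let (M , bound) = vertex-bound in
    ¬¬-enumerable (≡-dec ℤ._≟_) (cube d (t ℕ.* M)) λ p p∈tP → ∈-cube p (dilate-bound {t = t} {p} bound p∈tP)

  InDilate-0 : ∀ {p} → InDilate V 0 p → ∀ j → lookup p j ≡ ℤ.+ 0
  InDilate-0 (w , _ , _ , coords) j =
    ℤ→ℚ-injective (trans (coords j) (ℚ.*-zeroˡ (∑ λ i → w i * ℤ→ℚ (lookup (V i) j))))

  InDilate-scale : ∀ g t .{{_ : NonZero g}} (y : Vec ℤ d) → InDilate V (t ℕ.* g) (scale g y) ⇔ InDilate V t y
  InDilate-scale g t y = mk⇔ (λ (w , w≥0 , ∑w≡1 , coords) → w , w≥0 , ∑w≡1 , λ j → to (coordinate j _) (coords j))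
                             (λ (w , w≥0 , ∑w≡1 , coords) → w , w≥0 , ∑w≡1 , λ j → from (coordinate j _) (coords j))
    where
    coordinate : ∀ j s → ℤ→ℚ (lookup (scale g y) j) ≡ ℕ→ℚ (t ℕ.* g) * s ⇔ ℤ→ℚ (lookup y j) ≡ ℕ→ℚ t * s
    coordinate j s = mk⇔
      (λ eq → *-cancelˡ-≡ (ℕ→ℚ g) {{ℕ→ℚ-nonZero g}} (trans (sym scaled-point) (trans eq scaled-dilate)))
      (λ eq → trans scaled-point (trans (cong (ℕ→ℚ g *_) eq) (sym scaled-dilate)))
      where
      scaled-point : ℤ→ℚ (lookup (scale g y) j) ≡ ℕ→ℚ g * ℤ→ℚ (lookup y j)
      scaled-point = trans (cong ℤ→ℚ (lookup-map j (ℤ.+ g ℤ.*_) y)) (ℤ→ℚ-* (ℤ.+ g) (lookup y j))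
      scaled-dilate : ℕ→ℚ (t ℕ.* g) * s ≡ ℕ→ℚ g * (ℕ→ℚ t * s)
      scaled-dilate =
        trans (cong (_* s) (trans (cong ℕ→ℚ (ℕ.*-comm t g)) (ℕ→ℚ-* g t))) (ℚ.*-assoc (ℕ→ℚ g) (ℕ→ℚ t) s)

module Dilates {d m} (V : Points d m) =
  GcdStratification (InDilate V) gcdWith scale gcdWith-scale scale-injective (InDilate-scale V) scale-onto

gcdWith-0-zero : ∀ {d} (p : Vec ℤ d) → (∀ j → lookup p j ≡ ℤ.+ 0) → gcdWith 0 p ≡ 0
gcdWith-0-zero Vec.[] _ = gcd[0,0]≡0
gcdWith-0-zero (z Vec.∷ p) p≡0 rewrite p≡0 zero | gcdWith-0-zero p (p≡0 ∘ suc) = gcd[0,0]≡0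

module CoprimeEhrhart {d m} (V : Points d m) {r} (e : Fin (suc r) → ℚ)
  (ehrhart : ∀ n k → HasSize (InDilate V n) k → ℕ→ℚ k ≡ ∑ (λ i → e i * (ℕ→ℚ n ^ℚ toℕ i))) where

  open Dilates V

  jordanSum : ℕ → ℚ
  jordanSum n = ∑ λ i → e i * ℕ→ℚ (J (toℕ i) n)

  jordanSum-0 : jordanSum 0 ≡ 0ℚ
  jordanSum-0 = trans (∑-cong λ i → trans (cong (λ j → e i * ℕ→ℚ j) (J-0 (toℕ i))) (ℚ.*-zeroʳ (e i)))
                      (trans (∑≡sum {suc r} (λ _ → 0ℚ)) (sum-replicate-zero (suc r)))

  ehrhart-as-∑-divisors : ∀ n .{{_ : NonZero n}} →
    ∑ (λ i → e i * (ℕ→ℚ n ^ℚ toℕ i)) ≡ ∑-divisors n (λ _ t → jordanSum t)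
  ehrhart-as-∑-divisors n = trans (∑-cong λ i → cong (e i *_) (jordan (toℕ i) n))
                                  (∑-divisors-linear n e λ i _ t → ℕ→ℚ (J (toℕ i) t))

  Primitive-0-HasSize : HasSize (Primitive 0) 0
  Primitive-0-HasSize = [] , AllPairs.[] , none , refl
    where
    none : ∀ p → Primitive 0 p ⇔ p ∈ []
    none p = mk⇔ (λ (p∈0P , coprime) →
                   contradiction (trans (sym (gcdWith-0-zero p (InDilate-0 V {p} p∈0P))) coprime) ℕ.0≢1+n)
                 λ ()

  primitive-count : ∀ n k → HasSize (Primitive n) k → ℕ→ℚ k ≡ jordanSum n
  primitive-count = <-rec _ step
    where
    step : ∀ n → (∀ {t} → t < n → ∀ k → HasSize (Primitive t) k → ℕ→ℚ k ≡ jordanSum t) →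
           ∀ k → HasSize (Primitive n) k → ℕ→ℚ k ≡ jordanSum n
    step zero _ k hs = trans (cong ℕ→ℚ (HasSize-unique hs Primitive-0-HasSize)) (sym jordanSum-0)
    step n@(suc _) smaller k hs = decidable-stable (ℕ→ℚ k ℚ.≟ jordanSum n) (¬¬-map count (¬¬-dilate-enumerable V n))
      where
      count : Σ (List (Vec ℤ d)) (Enumerates (InDilate V n)) → ℕ→ℚ k ≡ jordanSum n
      count (xs , enum) = trans (cong ℕ→ℚ (HasSize-unique hs (stratum-HasSize 1 n (sym (ℕ.*-identityʳ n)) enum)))
        (∑-divisors-cancel n (begin
          ∑-divisors n (λ g _ → ℕ→ℚ (length (stratum (gcdWith n) g xs)))
            ≡⟨ length-as-∑-divisors (gcdWith n) n xs (λ {p} _ → gcdWith-∣ n p) ⟨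
          ℕ→ℚ (length xs)
            ≡⟨ ehrhart n (length xs) (Enumerates⇒HasSize enum) ⟩
          ∑ (λ i → e i * (ℕ→ℚ n ^ℚ toℕ i))
            ≡⟨ ehrhart-as-∑-divisors n ⟩
          ∑-divisors n (λ _ t → jordanSum t) ∎)
          λ g t 1<g n≡tg → smaller (cofactor-< t g 1<g n≡tg) _ (stratum-HasSize g t n≡tg enum))
        where open ≡-Reasoning

theorem1p1 : ∀ (d m : ℕ) (V : Points d m) (r : ℕ) → HasDim V r →
    (e : Fin (suc r) → ℚ) →
    (∀ (n k : ℕ) → HasSize (InDilate V n) k → ℕ→ℚ k ≡ ∑ (λ i → e i * (ℕ→ℚ n ^ℚ toℕ i))) →
    ∀ (n k : ℕ) → HasSize (λ (p : Vec ℤ d) → InDilate V n p × CoprimeTo n p) k →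
      ℕ→ℚ k ≡ ∑ (λ i → e i * ℕ→ℚ (J (toℕ i) n))
theorem1p1 d m V r _ e ehrhart = CoprimeEhrhart.primitive-count V e ehrhart
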